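{- Let ${\tt f}=f_0f_1f_2\cdots$ be the Fibonacci word. Then: (a) $\Delta p_{\tt a}$ is the sequence obtained from ${\tt f}$ under the coding ${\tt a}\mapsto2,\ {\tt b}\mapsto1$, i.e. $\Delta p_{\tt a}(n)=2$ if $f_{n-1}={\tt a}$ and $\Delta p_{\tt a}(n)=1$ if $f_{n-1}={\tt b}$; (b) $\Delta p_{\tt b}$ is the sequence obtained from ${\tt f}$ under the coding ${\tt a}\mapsto3,\ {\tt b}\mapsto2$; (c) $r(n)=n$ for all $n\geqslant1$ and $\Delta r(n)=1$ for all $n$; in particular $\Delta r$ is periodic.
   Context: The Fibonacci word ${\tt f}={\tt a}{\tt b}{\tt a}{\tt a}{\tt b}{\tt a}{\tt b}{\tt a}\cdots=\lim_{n\to\infty}\varrho_F^n({\tt a})$ is the fixed point of the substitution $\varrho_F:{\tt a}\mapsto{\tt a}{\tt b},\ {\tt b}\mapsto{\tt a}$, indexed from position $0$. For $n\geqslant1$, $p_{\tt a}(n)$ (resp. $p_{\tt b}(n)$) is the position of the $n$-th occurrence of ${\tt a}$ (resp. ${\tt b}$) in ${\tt f}$, $r(n)=p_{\tt b}(n)-p_{\tt a}(n)$, and $\Delta s(n)=s(n+1)-s(n)$ for any sequence $s$. -}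

module Defs where

open import Data.Nat using (ℕ; zero; suc; _+_)
open import Data.List using (List; []; _∷_; _++_)
open import Data.Product using (_×_)
open import Data.Empty using (⊥)
open import Relation.Binary.PropositionalEquality using (_≡_)

data Letter : Set where
  a b : Letter

ρF-letter : Letter → List Letter
ρF-letter a = a ∷ b ∷ []
ρF-letter b = a ∷ []

ρF : List Letter → List Letter
ρF [] = []
ρF (x ∷ xs) = ρF-letter x ++ ρF xs

iterF : ℕ → List Letter
iterF zero = a ∷ []
iterF (suc n) = ρF (iterF n)

-- k-th letter of a list (0-indexed), default a when out of range
nth : List Letter → ℕ → Letter
nth [] _ = a
nth (x ∷ xs) zero = x
nth (x ∷ xs) (suc k) = nth xs k

-- The Fibonacci word f = lim ρ_F^n(a), indexed from 0.
-- ρ_F^(k+1)(a) has length Fib(k+3) > k and each ρ_F^n(a) is a prefix of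
-- ρ_F^(n+1)(a), so f_k is the k-th letter of ρ_F^(k+1)(a).
fib : ℕ → Letter
fib k = nth (iterF (suc k)) k

ind : Letter → Letter → ℕ
ind a a = 1
ind b b = 1
ind a b = 0
ind b a = 0

count : Letter → ℕ → ℕ
count x zero = 0
count x (suc m) = count x m + ind (fib m) x

-- p is the position of the n-th occurrence (n ≥ 1) of x in f,
-- i.e. p_x(n) = p.  (Stated for n = suc m: f_p = x and exactly m earlier x's.)
IsOcc : Letter → ℕ → ℕ → Set
IsOcc x (suc m) p = (fib p ≡ x) × (count x p ≡ m)
IsOcc x zero p = ⊥

codeA : Letter → ℕ
codeA a = 2
codeA b = 1

codeB : Letter → ℕ
codeB a = 3
codeB b = 2

{-# OPTIONS --safe #-}
-- Since f = ρF(f) = ρF(f₀) ρF(f₁) ⋯, the image ρF(f_j) starts in f at posA j = Σ_{i<j} |ρF(f_i)|.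
-- Every image begins with a and contains exactly one a, so posA j is the position of the
-- (j+1)-th a, and Δp_a(j+1) = |ρF(f_j)| = codeA(f_j). Every b is the second letter of the image
-- ab of an a, so the (m+1)-th b sits at posA (posA m) + 1 = posA m + m + 1; this is r(n) = n,
-- and (b) follows from (a).
module Submission where

open import Defs
open import Function using (_∘_)
open import Data.Nat using (ℕ; zero; suc; _+_; _≤_; _<_; _≤′_; ≤′-refl; ≤′-step; z≤n; s≤s)
open import Data.Nat.Properties
open import Data.Nat.Tactic.RingSolver using (solve-∀)
open import Data.List using (List; []; _∷_; _++_; length; map)
open import Data.Nat.ListAction using (sum)
open import Data.List.Properties using (++-assoc)
open import Data.Product using (_×_; ∃; _,_; map₂)
open import Relation.Nullary using (¬_)
open import Relation.Binary.PropositionalEquality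

infix 4 _[_]=_

data _[_]=_ {A : Set} : List A → ℕ → A → Set where
  here  : ∀ {x xs} → (x ∷ xs) [ zero ]= x
  there : ∀ {x xs k y} → xs [ k ]= y → (x ∷ xs) [ suc k ]= y

[]=⇒nth : ∀ {w k x} → w [ k ]= x → nth w k ≡ x
[]=⇒nth here      = refl
[]=⇒nth (there p) = []=⇒nth p

[]=-functional : ∀ {A : Set} {w : List A} {k x y} → w [ k ]= x → w [ k ]= y → x ≡ y
[]=-functional here      here      = refl
[]=-functional (there p) (there q) = []=-functional p q

[]=-++⁺ˡ : ∀ {A : Set} {w : List A} {k x} t → w [ k ]= x → (w ++ t) [ k ]= x
[]=-++⁺ˡ t here      = here
[]=-++⁺ˡ t (there p) = there ([]=-++⁺ˡ t p)

[]=-++⁺ʳ : ∀ {A : Set} (u : List A) {w k x} → w [ k ]= x → (u ++ w) [ length u + k ]= x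
[]=-++⁺ʳ []      p = p
[]=-++⁺ʳ (_ ∷ u) p = there ([]=-++⁺ʳ u p)

<length⇒[]= : ∀ {A : Set} {w : List A} {k} → k < length w → ∃ λ x → w [ k ]= x
<length⇒[]= {w = x ∷ _} {zero}  _         = x , here
<length⇒[]= {w = _ ∷ _} {suc k} (s≤s k<n) = map₂ there (<length⇒[]= k<n)

ρF-++ : ∀ u w → ρF (u ++ w) ≡ ρF u ++ ρF w
ρF-++ []      w = refl
ρF-++ (x ∷ u) w =
  trans (cong (ρF-letter x ++_) (ρF-++ u w)) (sym (++-assoc (ρF-letter x) (ρF u) (ρF w)))

iterF-prefix : ∀ n → ∃ λ t → iterF (suc n) ≡ iterF n ++ t
iterF-prefix zero    = b ∷ [] , refl
iterF-prefix (suc n) with iterF-prefix n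
... | t , eq = ρF t , trans (cong ρF eq) (ρF-++ (iterF n) t)

iterF-[]=-mono : ∀ {m n k x} → m ≤′ n → iterF m [ k ]= x → iterF n [ k ]= x
iterF-[]=-mono ≤′-refl p = p
iterF-[]=-mono {n = suc n} {k} {x} (≤′-step m≤n) p with iterF-prefix n
... | t , eq = subst (_[ k ]= x) (sym eq) ([]=-++⁺ˡ t (iterF-[]=-mono m≤n p))

iterF-head : ∀ n → ∃ λ t → iterF n ≡ a ∷ t
iterF-head zero    = [] , refl
iterF-head (suc n) with iterF-head n
... | t , eq = b ∷ ρF t , cong ρF eq

length-ρF : ∀ w → length w ≤ length (ρF w)
length-ρF []      = z≤n
length-ρF (a ∷ w) = s≤s (m≤n⇒m≤1+n (length-ρF w))
length-ρF (b ∷ w) = s≤s (length-ρF w)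

n<length-iterF : ∀ n → n < length (iterF (suc n))
n<length-iterF zero = s≤s z≤n
n<length-iterF (suc n) with iterF (suc n) | iterF-head (suc n) | n<length-iterF n
... | .(a ∷ t) | t , refl | n<len = s≤s (≤-trans n<len (s≤s (length-ρF t)))

fib-stable : ∀ n {k x} → iterF n [ k ]= x → fib k ≡ x
fib-stable n {k} p with <length⇒[]= (n<length-iterF k)
... | _ , q =
  trans ([]=⇒nth q) ([]=-functional (lift (m≤n+m (suc k) n) q) (lift (m≤m+n n (suc k)) p))
  where
  lift : ∀ {m x} → m ≤ n + suc k → iterF m [ k ]= x → iterF (n + suc k) [ k ]= x
  lift = iterF-[]=-mono ∘ ≤⇒≤′

nth-iterF : ∀ n {i} → i < length (iterF n) → nth (iterF n) i ≡ fib i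
nth-iterF n i<len with <length⇒[]= i<len
... | _ , p = trans ([]=⇒nth p) (sym (fib-stable n p))

imageStart : List Letter → ℕ → ℕ
imageStart w zero    = 0
imageStart w (suc j) = imageStart w j + length (ρF-letter (nth w j))

imageStart-∷ : ∀ x w j → imageStart (x ∷ w) (suc j) ≡ length (ρF-letter x) + imageStart w j
imageStart-∷ x w zero    = sym (+-identityʳ _)
imageStart-∷ x w (suc j) =
  trans (cong (_+ length (ρF-letter (nth w j))) (imageStart-∷ x w j))
        (+-assoc (length (ρF-letter x)) (imageStart w j) _)

ρF-[]= : ∀ {w j x i y} → w [ j ]= x → ρF-letter x [ i ]= y → ρF w [ imageStart w j + i ]= y
ρF-[]= {x ∷ w} here q = []=-++⁺ˡ (ρF w) q
ρF-[]= {x ∷ w} {suc j} {i = i} {y} (there p) q =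
  subst (λ k → ρF (x ∷ w) [ k ]= y) shift ([]=-++⁺ʳ (ρF-letter x) (ρF-[]= p q))
  where
  shift : length (ρF-letter x) + (imageStart w j + i) ≡ imageStart (x ∷ w) (suc j) + i
  shift = trans (sym (+-assoc (length (ρF-letter x)) (imageStart w j) i))
                (cong (_+ i) (sym (imageStart-∷ x w j)))

posA : ℕ → ℕ
posA zero    = 0
posA (suc j) = posA j + length (ρF-letter (fib j))

imageStart-iterF : ∀ n j → j ≤ length (iterF n) → imageStart (iterF n) j ≡ posA j
imageStart-iterF n zero    _     = refl
imageStart-iterF n (suc j) j<len =
  cong₂ _+_ (imageStart-iterF n j (<⇒≤ j<len)) (cong (length ∘ ρF-letter) (nth-iterF n j<len))

FactorAt : List Letter → ℕ → Set
FactorAt u s = ∀ {i y} → u [ i ]= y → fib (s + i) ≡ y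

image-factor : ∀ j → FactorAt (ρF-letter (fib j)) (posA j)
image-factor j {i} {y} q with <length⇒[]= (n<length-iterF j)
... | x , p with fib-stable (suc j) p
... | refl = subst (λ s → fib (s + i) ≡ y) (imageStart-iterF (suc j) j (<⇒≤ (n<length-iterF j)))
                   (fib-stable (suc (suc j)) (ρF-[]= p q))

occurrences : Letter → List Letter → ℕ
occurrences x u = sum (map (λ y → ind y x) u)

count-factor : ∀ x s u → FactorAt u s → count x (s + length u) ≡ count x s + occurrences x u
count-factor x s []      _ = trans (cong (count x) (+-identityʳ s)) (sym (+-identityʳ _))
count-factor x s (y ∷ u) f = begin
  count x (s + suc (length u))          ≡⟨ cong (count x) (+-suc s (length u)) ⟩
  count x (suc s + length u)            ≡⟨ count-factor x (suc s) u f′ ⟩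
  count x s + ind (fib s) x + occurrences x u
    ≡⟨ cong (λ z → count x s + ind z x + occurrences x u) f₀ ⟩
  count x s + ind y x + occurrences x u ≡⟨ +-assoc (count x s) (ind y x) _ ⟩
  count x s + occurrences x (y ∷ u)     ∎
  where
  open ≡-Reasoning
  f₀ : fib s ≡ y
  f₀ = trans (cong fib (sym (+-identityʳ s))) (f here)
  f′ : FactorAt u (suc s)
  f′ {i} p = trans (cong fib (sym (+-suc s i))) (f (there p))

occurrences-a-ρF-letter : ∀ y → occurrences a (ρF-letter y) ≡ 1
occurrences-a-ρF-letter a = refl
occurrences-a-ρF-letter b = refl

occurrences-b-ρF-letter : ∀ y → occurrences b (ρF-letter y) ≡ ind y a
occurrences-b-ρF-letter a = refl
occurrences-b-ρF-letter b = refl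

count-a-posA : ∀ j → count a (posA j) ≡ j
count-a-posA zero    = refl
count-a-posA (suc j) = trans (count-factor a (posA j) (ρF-letter (fib j)) (image-factor j))
  (trans (cong₂ _+_ (count-a-posA j) (occurrences-a-ρF-letter (fib j))) (+-comm j 1))

count-b-posA : ∀ j → count b (posA j) ≡ count a j
count-b-posA zero    = refl
count-b-posA (suc j) = trans (count-factor b (posA j) (ρF-letter (fib j)) (image-factor j))
  (cong₂ _+_ (count-b-posA j) (occurrences-b-ρF-letter (fib j)))

ρF-letter-head : ∀ y → ρF-letter y [ 0 ]= a
ρF-letter-head a = here
ρF-letter-head b = here

fib-posA : ∀ j → fib (posA j) ≡ a
fib-posA j = trans (cong fib (sym (+-identityʳ (posA j)))) (image-factor j (ρF-letter-head (fib j)))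

fib-suc-posA : ∀ j → fib j ≡ a → fib (suc (posA j)) ≡ b
fib-suc-posA j fj≡a = trans (cong fib (+-comm 1 (posA j)))
  (image-factor j (subst (λ y → ρF-letter y [ 1 ]= b) (sym fj≡a) (there here)))

length-ρF-letter : ∀ y → length (ρF-letter y) ≡ suc (ind y a)
length-ρF-letter a = refl
length-ρF-letter b = refl

posA≡ : ∀ j → posA j ≡ j + count a j
posA≡ zero    = refl
posA≡ (suc j) = begin
  posA j + length (ρF-letter (fib j))   ≡⟨ cong₂ _+_ (posA≡ j) (length-ρF-letter (fib j)) ⟩
  j + count a j + suc (ind (fib j) a)  ≡⟨ +-suc (j + count a j) _ ⟩
  suc (j + count a j + ind (fib j) a)  ≡⟨ cong suc (+-assoc j (count a j) _) ⟩
  suc j + (count a j + ind (fib j) a)  ∎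
  where open ≡-Reasoning

posB : ℕ → ℕ
posB m = suc (posA (posA m))

fib-posB : ∀ m → fib (posB m) ≡ b
fib-posB m = fib-suc-posA (posA m) (fib-posA m)

count-b-posB : ∀ m → count b (posB m) ≡ m
count-b-posB m = trans (cong₂ _+_ (trans (count-b-posA (posA m)) (count-a-posA m))
                                  (cong (λ y → ind y b) (fib-posA (posA m))))
                       (+-identityʳ m)

posB≡ : ∀ m → posB m ≡ posA m + suc m
posB≡ m = begin
  suc (posA (posA m))            ≡⟨ cong suc (posA≡ (posA m)) ⟩
  suc (posA m + count a (posA m)) ≡⟨ cong (λ c → suc (posA m + c)) (count-a-posA m) ⟩
  suc (posA m + m)               ≡⟨ sym (+-suc (posA m) m) ⟩
  posA m + suc m                 ∎
  where open ≡-Reasoning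

posA-suc : ∀ j → posA (suc j) ≡ posA j + codeA (fib j)
posA-suc j = cong (posA j +_) (length≡codeA (fib j))
  where
  length≡codeA : ∀ y → length (ρF-letter y) ≡ codeA y
  length≡codeA a = refl
  length≡codeA b = refl

posB-suc : ∀ m → posB (suc m) ≡ posB m + codeB (fib m)
posB-suc m = begin
  posB (suc m)                            ≡⟨ posB≡ (suc m) ⟩
  posA (suc m) + suc (suc m)              ≡⟨ cong (_+ suc (suc m)) (posA-suc m) ⟩
  posA m + codeA (fib m) + suc (suc m)    ≡⟨ shuffle (posA m) (codeA (fib m)) m ⟩
  posA m + suc m + suc (codeA (fib m))    ≡⟨ cong₂ _+_ (sym (posB≡ m)) (codeB≡suc-codeA (fib m)) ⟩
  posB m + codeB (fib m)                  ∎
  where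
  open ≡-Reasoning
  shuffle : ∀ p c m → p + c + suc (suc m) ≡ p + suc m + suc c
  shuffle = solve-∀
  codeB≡suc-codeA : ∀ y → suc (codeA y) ≡ codeB y
  codeB≡suc-codeA a = refl
  codeB≡suc-codeA b = refl

count-mono : ∀ x {p q} → p ≤′ q → count x p ≤ count x q
count-mono x ≤′-refl        = ≤-refl
count-mono x (≤′-step p≤′q) = ≤-trans (count-mono x p≤′q) (m≤m+n _ _)

count-suc-occurrence : ∀ {x} p → fib p ≡ x → count x (suc p) ≡ suc (count x p)
count-suc-occurrence p refl = trans (cong (count (fib p) p +_) (ind-self (fib p))) (+-comm _ 1)
  where
  ind-self : ∀ y → ind y y ≡ 1
  ind-self a = refl
  ind-self b = refl

IsOcc-posA : ∀ n → IsOcc a (suc n) (posA n)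
IsOcc-posA n = fib-posA n , count-a-posA n

IsOcc-posB : ∀ n → IsOcc b (suc n) (posB n)
IsOcc-posB n = fib-posB n , count-b-posB n

IsOcc-≮ : ∀ {x m p q} → IsOcc x (suc m) p → IsOcc x (suc m) q → ¬ q < p
IsOcc-≮ {x} {m} {q = q} (fp , cp) (fq , cq) q<p =
  n≮n m (subst₂ _≤_ (trans (count-suc-occurrence q fq) (cong suc cq)) cp
                    (count-mono x (≤⇒≤′ q<p)))

IsOcc-unique : ∀ {x m} p q → IsOcc x (suc m) p → IsOcc x (suc m) q → p ≡ q
IsOcc-unique _ _ op oq = ≤-antisym (≮⇒≥ (IsOcc-≮ op oq)) (≮⇒≥ (IsOcc-≮ oq op))

theorem4p2 :
    -- p_a(n), p_b(n) are well defined for all n ≥ 1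
    ((n : ℕ) → ∃ λ p → IsOcc a (suc n) p)
    × ((n : ℕ) → ∃ λ p → IsOcc b (suc n) p)
    -- (a) Δp_a(n) = codeA(f_{n-1}) for n = m+1 ≥ 1
    × ((m p q : ℕ) → IsOcc a (suc m) p → IsOcc a (suc (suc m)) q →
        q ≡ p + codeA (fib m))
    -- (b) Δp_b(n) = codeB(f_{n-1})
    × ((m p q : ℕ) → IsOcc b (suc m) p → IsOcc b (suc (suc m)) q →
        q ≡ p + codeB (fib m))
    -- (c) r(n) = p_b(n) - p_a(n) = n for n ≥ 1
    × ((n p q : ℕ) → IsOcc a (suc n) p → IsOcc b (suc n) q →
        q ≡ p + suc n)
    -- (c) Δr(n) = r(n+1) - r(n) = 1 for n ≥ 1
    × ((n p q p' q' : ℕ) → IsOcc a (suc n) p → IsOcc b (suc n) q →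
        IsOcc a (suc (suc n)) p' → IsOcc b (suc (suc n)) q' →
        q' + p ≡ suc (q + p'))
theorem4p2 = (λ n → posA n , IsOcc-posA n) , (λ n → posB n , IsOcc-posB n) , Δa , Δb , r , Δr
  where
  Δa : ∀ m p q → IsOcc a (suc m) p → IsOcc a (suc (suc m)) q → q ≡ p + codeA (fib m)
  Δa m p q op oq with IsOcc-unique p (posA m) op (IsOcc-posA m)
                    | IsOcc-unique q (posA (suc m)) oq (IsOcc-posA (suc m))
  ... | refl | refl = posA-suc m

  Δb : ∀ m p q → IsOcc b (suc m) p → IsOcc b (suc (suc m)) q → q ≡ p + codeB (fib m)
  Δb m p q op oq with IsOcc-unique p (posB m) op (IsOcc-posB m)
                    | IsOcc-unique q (posB (suc m)) oq (IsOcc-posB (suc m))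
  ... | refl | refl = posB-suc m

  r : ∀ n p q → IsOcc a (suc n) p → IsOcc b (suc n) q → q ≡ p + suc n
  r n p q op oq with IsOcc-unique p (posA n) op (IsOcc-posA n)
                   | IsOcc-unique q (posB n) oq (IsOcc-posB n)
  ... | refl | refl = posB≡ n

  interchange : ∀ n p p′ → p′ + suc (suc n) + p ≡ suc (p + suc n + p′)
  interchange = solve-∀

  Δr : ∀ n p q p′ q′ → IsOcc a (suc n) p → IsOcc b (suc n) q →
       IsOcc a (suc (suc n)) p′ → IsOcc b (suc (suc n)) q′ → q′ + p ≡ suc (q + p′)
  Δr n p q p′ q′ op oq op′ oq′ with r n p q op oq | r (suc n) p′ q′ op′ oq′
  ... | refl | refl = interchange n p p′
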